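{- Let $(\lambda,\mu)\in{\sf Kostka}_r^{\mathbb Z}$. If the canonical matrix $A(\lambda,\mu)$ is reducible, then $(\lambda,\mu)$ is reducible in ${\sf Kostka}_r^{\mathbb Z}$.
   Context: ${\sf Kostka}_r^{\mathbb Z}$ is the semigroup (componentwise addition) of pairs $(\lambda,\mu)$ of partitions with at most $r$ nonzero parts, $|\lambda|=|\mu|$, $\sum_{i\le t}\lambda_i\ge\sum_{i\le t}\mu_i$ for all $t$. $(\lambda,\mu)$ is reducible if it equals a sum of two nonzero elements of ${\sf Kostka}_r^{\mathbb Z}$. $\lambda'$ is the conjugate partition. Canonical (Ryser) matrix $A(\lambda,\mu)$: let $s=\lambda_1$. Start with the $r\times s$ $\{0,1\}$-matrix whose row $i$ has $\mu_i$ ones in columns $1,\ldots,\mu_i$. For $j=s,s-1,\ldots,1$ in turn: looking only at columns $1,\ldots,j$ of the current matrix, choose $\lambda'_j$ rows, taking rows with the largest number of $1$'s in columns $1,\ldots,j$ and breaking ties by preferring rows further south; in each chosen row, move the rightmost $1$ among columns $1,\ldots,j$ to column $j$. The final matrix is $A(\lambda,\mu)$ (row sums $\mu_i$, column sums $\lambda'_j$). $A(\lambda,\mu)$ is \emph{reducible} if there is a nontrivial subset $S$ of its columns (i.e., $S\neq\emptyset$ and $S$ not all columns) such that the sum of the columns in $S$ is (the vector of parts of) a partition with at most $r$ parts, i.e., is weakly decreasing with nonnegative entries, and the sum of the columns not in $S$ is also such a partition. -}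

module Defs where

open import Data.Nat using (ℕ; zero; suc; _+_; _≤_; _<ᵇ_; _≡ᵇ_)
open import Data.Bool using (Bool; true; false; if_then_else_; _∧_; _∨_; not)
open import Data.Fin using (Fin; toℕ)
open import Data.Vec using (Vec; []; _∷_; lookup; zipWith; replicate; sum)
open import Data.Product using (Σ; _×_; ∃; ∃-syntax)
open import Relation.Binary.PropositionalEquality using (_≡_)
open import Relation.Nullary using (¬_)

sumFin : {n : ℕ} → (Fin n → ℕ) → ℕ
sumFin {zero}  f = 0
sumFin {suc n} f = f Fin.zero + sumFin (λ i → f (Fin.suc i))

countFin : {n : ℕ} → (Fin n → Bool) → ℕ
countFin p = sumFin (λ i → if p i then 1 else 0)

allFinB : {n : ℕ} → (Fin n → Bool) → Bool
allFinB {zero}  p = true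
allFinB {suc n} p = p Fin.zero ∧ allFinB (λ i → p (Fin.suc i))

anyFinB : {n : ℕ} → (Fin n → Bool) → Bool
anyFinB {zero}  p = false
anyFinB {suc n} p = p Fin.zero ∨ anyFinB (λ i → p (Fin.suc i))

-- Partitions with at most r parts: length-r vectors (padded by zeros),
-- weakly decreasing (nonnegativity is automatic in ℕ).

IsPartition : {r : ℕ} → Vec ℕ r → Set
IsPartition {r} v = (i j : Fin r) → toℕ i ≤ toℕ j → lookup v j ≤ lookup v i

IsPartitionF : {r : ℕ} → (Fin r → ℕ) → Set
IsPartitionF {r} v = (i j : Fin r) → toℕ i ≤ toℕ j → v j ≤ v i

psum : {r : ℕ} → ℕ → Vec ℕ r → ℕ
psum zero    v        = 0
psum (suc t) []       = 0
psum (suc t) (x ∷ xs) = x + psum t xs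

InKostka : {r : ℕ} → Vec ℕ r → Vec ℕ r → Set
InKostka lam mu =
  IsPartition lam × IsPartition mu × sum lam ≡ sum mu ×
  ((t : ℕ) → psum t mu ≤ psum t lam)

NonZeroPair : {r : ℕ} → Vec ℕ r → Vec ℕ r → Set
NonZeroPair {r} a b = ¬ (a ≡ replicate r 0 × b ≡ replicate r 0)

KostkaReducible : {r : ℕ} → Vec ℕ r → Vec ℕ r → Set
KostkaReducible {r} lam mu =
  ∃[ a ] ∃[ b ] ∃[ c ] ∃[ d ]
    (InKostka {r} a b × InKostka c d × NonZeroPair a b × NonZeroPair c d ×
     lam ≡ zipWith _+_ a c × mu ≡ zipWith _+_ b d)

-- The canonical (Ryser) matrix.  Rows indexed by Fin r (row i ↔ row i+1),
-- columns by Fin s (column k ↔ column k+1), entries 0/1 stored in ℕ.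

firstPart : {r : ℕ} → Vec ℕ r → ℕ
firstPart []      = 0
firstPart (x ∷ _) = x

Matrix : ℕ → ℕ → Set
Matrix r s = Fin r → Fin s → ℕ

-- conjugate partition, 0-indexed column j: λ'_{j+1} = #{ i | λ_i ≥ j+1 }
conj : {r : ℕ} → Vec ℕ r → ℕ → ℕ
conj lam j = countFin (λ i → j <ᵇ lookup lam i)

initMatrix : {r s : ℕ} → Vec ℕ r → Matrix r s
initMatrix mu i k = if toℕ k <ᵇ lookup mu i then 1 else 0

-- one step of the algorithm for (0-indexed) column j, with target count n = λ'_{j+1}
module _ {r s : ℕ} (n j : ℕ) (M : Matrix r s) where
  inRange : Fin s → Bool
  inRange k = toℕ k <ᵇ suc j

  cnt : Fin r → ℕ
  cnt i = sumFin (λ k → if inRange k then M i k else 0)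

  preferred : Fin r → Fin r → Bool
  preferred k i = (cnt i <ᵇ cnt k) ∨ ((cnt k ≡ᵇ cnt i) ∧ (toℕ i <ᵇ toℕ k))

  chosen : Fin r → Bool
  chosen i = countFin (λ k → preferred k i) <ᵇ n

  isRightmostOne : Fin r → Fin s → Bool
  isRightmostOne i k =
    (M i k ≡ᵇ 1) ∧ inRange k ∧
    allFinB (λ k' → not ((toℕ k <ᵇ toℕ k') ∧ inRange k') ∨ (M i k' ≡ᵇ 0))

  hasOne : Fin r → Bool
  hasOne i = anyFinB (λ k → isRightmostOne i k)

  step : Matrix r s
  step i k =
    if chosen i ∧ hasOne i
    then (if toℕ k ≡ᵇ j then 1 else if isRightmostOne i k then 0 else M i k)
    else M i k

-- process columns m-1, m-2, ..., 0 in turn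
runSteps : {r s : ℕ} → Vec ℕ r → ℕ → Matrix r s → Matrix r s
runSteps lam zero    M = M
runSteps lam (suc m) M = runSteps lam m (step (conj lam m) m M)

canonical : {r : ℕ} (lam mu : Vec ℕ r) → Matrix r (firstPart lam)
canonical lam mu = runSteps lam (firstPart lam) (initMatrix mu)

colSum : {r s : ℕ} → Matrix r s → (Fin s → Bool) → Fin r → ℕ
colSum M S i = sumFin (λ k → if S k then M i k else 0)

MatrixReducible : {r s : ℕ} → Matrix r s → Set
MatrixReducible {r} {s} M =
  Σ (Fin s → Bool) λ S →
    (∃[ k ] S k ≡ true) × (∃[ k ] S k ≡ false) ×
    IsPartitionF (colSum M S) × IsPartitionF (colSum M (λ k → not (S k)))

-- The canonical matrix A is a 0/1 matrix with row sums μ and column sums λ′ (Gale–Ryser).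
-- Before column j+1 is filled, the numbers c of ones of the rows in columns 1..j+1 form a
-- left-justified shape majorized by λ cut off after j+1 columns; this forces every one of the
-- λ′_{j+1} chosen rows to own a one, and survives moving those ones into column j+1.
-- Given a splitting column set S, let α_S be the partition whose conjugate is (λ′_k)_{k∈S}
-- (the rows of the Young diagram of λ restricted to the columns in S) and β_S the row sums of
-- A on S.  Then λ = α_S + α_{S̄}, μ = β_S + β_{S̄}, and β_S ≼ α_S because a 0/1 column with
-- λ′_k ones has at most t ⊓ λ′_k of them in its top t rows, while the diagram has exactly that.

module Submission where

open import Defs
open import Data.Nat using (ℕ; zero; suc; _+_; _*_; _∸_; _⊓_; _≤_; _<_; _>_; _≮_; z≤n; s≤s; _<ᵇ_; _≡ᵇ_)
open import Data.Nat.Properties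
open import Algebra.Properties.CommutativeSemigroup +-commutativeSemigroup
  using () renaming (interchange to +-interchange)
open import Data.Bool using (Bool; true; false; if_then_else_; _∧_; _∨_; not)
import Data.Bool.Properties as Bool
open import Data.Fin using (Fin; toℕ; zero; suc; fromℕ<)
import Data.Fin.Properties as Fin
open import Data.Vec using (Vec; []; _∷_; lookup; tabulate; zipWith; replicate; sum)
open import Data.Vec.Properties using (lookup∘tabulate; lookup-zipWith)
open import Data.Vec.Relation.Binary.Pointwise.Extensional using (ext; Pointwise-≡⇒≡)
open import Data.Product using (_×_; _,_; proj₁; proj₂)
open import Data.Product.Relation.Binary.Lex.Strict using (×-Lex; ×-transitive)
open import Data.Sum using (_⊎_; inj₁; inj₂)
open import Function using (_∘_)
open import Data.Empty using (⊥-elim)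
open import Relation.Binary using (tri<; tri≈; tri>)
open import Relation.Binary.PropositionalEquality hiding ([_])
open import Relation.Nullary using (¬_; yes; no)
open import Relation.Nullary.Decidable using (_×-dec_)
open import Relation.Nullary.Reflects using (Reflects; ofʸ; ofⁿ; fromEquivalence; _⊎-reflects_; _×-reflects_)

[_] : Bool → ℕ
[ b ] = if b then 1 else 0

[_]≤1 : ∀ b → [ b ] ≤ 1
[ true ]≤1 = ≤-refl
[ false ]≤1 = z≤n

true≢false : true ≢ false
true≢false ()

module _ {p} {P : Set p} {b : Bool} where
  reflects-true : Reflects P b → P → b ≡ true
  reflects-true (ofʸ _) p = refl
  reflects-true (ofⁿ ¬p) p = ⊥-elim (¬p p)

  reflects-false : Reflects P b → ¬ P → b ≡ false
  reflects-false (ofʸ p) ¬p = ⊥-elim (¬p p)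
  reflects-false (ofⁿ _) ¬p = refl

  reflects-true⁻¹ : Reflects P b → b ≡ true → P
  reflects-true⁻¹ (ofʸ p) e = p
  reflects-true⁻¹ (ofⁿ _) ()

  reflects-false⁻¹ : Reflects P b → b ≡ false → ¬ P
  reflects-false⁻¹ (ofʸ _) ()
  reflects-false⁻¹ (ofⁿ ¬p) e = ¬p

≡ᵇ-reflects-≡ : ∀ m n → Reflects (m ≡ n) (m ≡ᵇ n)
≡ᵇ-reflects-≡ m n = fromEquivalence (≡ᵇ⇒≡ m n) (≡⇒≡ᵇ m n)

<ᵇ-true : ∀ {m n} → m < n → (m <ᵇ n) ≡ true
<ᵇ-true = reflects-true (<ᵇ-reflects-< _ _)

<ᵇ-false : ∀ {m n} → n ≤ m → (m <ᵇ n) ≡ false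
<ᵇ-false n≤m = reflects-false (<ᵇ-reflects-< _ _) (≤⇒≯ n≤m)

<ᵇ-true⁻¹ : ∀ m n → (m <ᵇ n) ≡ true → m < n
<ᵇ-true⁻¹ m n = reflects-true⁻¹ (<ᵇ-reflects-< m n)

<ᵇ-false⁻¹ : ∀ m n → (m <ᵇ n) ≡ false → n ≤ m
<ᵇ-false⁻¹ m n e = ≮⇒≥ (reflects-false⁻¹ (<ᵇ-reflects-< m n) e)

≡ᵇ-true : ∀ {m n} → m ≡ n → (m ≡ᵇ n) ≡ true
≡ᵇ-true = reflects-true (≡ᵇ-reflects-≡ _ _)

≡ᵇ-false : ∀ {m n} → m ≢ n → (m ≡ᵇ n) ≡ false
≡ᵇ-false = reflects-false (≡ᵇ-reflects-≡ _ _)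

≡ᵇ-true⁻¹ : ∀ m n → (m ≡ᵇ n) ≡ true → m ≡ n
≡ᵇ-true⁻¹ m n = reflects-true⁻¹ (≡ᵇ-reflects-≡ m n)

<ᵇ-pred : ∀ m n → suc m ≢ n → (m <ᵇ n) ≡ (m <ᵇ n ∸ 1)
<ᵇ-pred m zero _ = refl
<ᵇ-pred m (suc n) 1+m≢1+n with m <ᵇ n | <ᵇ-reflects-< m n
... | true | ofʸ m<n = <ᵇ-true (m<n⇒m<1+n m<n)
... | false | ofⁿ m≮n = <ᵇ-false (≤∧≢⇒< (≮⇒≥ m≮n) (λ n≡m → 1+m≢1+n (cong suc (sym n≡m))))

if-<ᵇ-suc : ∀ a j x → (if a <ᵇ suc j then x else 0) ≡ (if a <ᵇ j then x else 0) + (if a ≡ᵇ j then x else 0)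
if-<ᵇ-suc zero zero x = refl
if-<ᵇ-suc zero (suc j) x = sym (+-identityʳ x)
if-<ᵇ-suc (suc a) zero x = refl
if-<ᵇ-suc (suc a) (suc j) x = if-<ᵇ-suc a j x

sumFin-cong : ∀ {n} {f g : Fin n → ℕ} → (∀ i → f i ≡ g i) → sumFin f ≡ sumFin g
sumFin-cong {zero} f≗g = refl
sumFin-cong {suc n} f≗g = cong₂ _+_ (f≗g zero) (sumFin-cong (λ i → f≗g (suc i)))

sumFin-mono : ∀ {n} {f g : Fin n → ℕ} → (∀ i → f i ≤ g i) → sumFin f ≤ sumFin g
sumFin-mono {zero} f≤g = z≤n
sumFin-mono {suc n} f≤g = +-mono-≤ (f≤g zero) (sumFin-mono (λ i → f≤g (suc i)))

sumFin-mono-< : ∀ {n} {f g : Fin n → ℕ} → (∀ i → f i ≤ g i) → ∀ a → f a < g a → sumFin f < sumFin g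
sumFin-mono-< f≤g zero fa<ga = +-mono-<-≤ fa<ga (sumFin-mono (λ i → f≤g (suc i)))
sumFin-mono-< f≤g (suc a) fa<ga = +-mono-≤-< (f≤g zero) (sumFin-mono-< (λ i → f≤g (suc i)) a fa<ga)

sumFin-point : ∀ {n} (f : Fin n → ℕ) a → f a ≤ sumFin f
sumFin-point f zero = m≤m+n _ _
sumFin-point f (suc a) = ≤-trans (sumFin-point (λ i → f (suc i)) a) (m≤n+m _ (f zero))

sumFin-const : ∀ n c → sumFin {n} (λ _ → c) ≡ n * c
sumFin-const zero c = refl
sumFin-const (suc n) c = cong (c +_) (sumFin-const n c)

sumFin-one : ∀ n → sumFin {n} (λ _ → 1) ≡ n
sumFin-one n = trans (sumFin-const n 1) (*-identityʳ n)

sumFin-zero : ∀ n → sumFin {n} (λ _ → 0) ≡ 0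
sumFin-zero n = trans (sumFin-const n 0) (*-zeroʳ n)

sumFin-+ : ∀ {n} (f g : Fin n → ℕ) → sumFin (λ i → f i + g i) ≡ sumFin f + sumFin g
sumFin-+ {zero} f g = refl
sumFin-+ {suc n} f g = trans (cong ((f zero + g zero) +_) (sumFin-+ (λ i → f (suc i)) (λ i → g (suc i))))
                             (+-interchange (f zero) (g zero) _ _)

sumFin-* : ∀ {n} c (f : Fin n → ℕ) → sumFin (λ i → c * f i) ≡ c * sumFin f
sumFin-* {zero} c f = sym (*-zeroʳ c)
sumFin-* {suc n} c f = trans (cong (c * f zero +_) (sumFin-* c (λ i → f (suc i))))
                             (sym (*-distribˡ-+ c (f zero) _))

sumFin-if : ∀ {n} b (f : Fin n → ℕ) → sumFin (λ i → if b then f i else 0) ≡ (if b then sumFin f else 0)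
sumFin-if true f = refl
sumFin-if {n} false f = sumFin-zero n

sumFin-swap : ∀ {m n} (f : Fin m → Fin n → ℕ) →
  sumFin (λ i → sumFin (f i)) ≡ sumFin (λ k → sumFin (λ i → f i k))
sumFin-swap {zero} {n} f = sym (sumFin-zero n)
sumFin-swap {suc m} f = trans (cong (sumFin (f zero) +_) (sumFin-swap (λ i → f (suc i))))
                              (sym (sumFin-+ (f zero) (λ k → sumFin (λ i → f (suc i) k))))

sumFin-single : ∀ {n} (f : Fin n → ℕ) a → (∀ k → k ≢ a → f k ≡ 0) → sumFin f ≡ f a
sumFin-single {suc n} f zero others = begin
  f zero + sumFin (λ i → f (suc i)) ≡⟨ cong (f zero +_) (sumFin-cong (λ i → others (suc i) λ ())) ⟩
  f zero + sumFin {n} (λ _ → 0)     ≡⟨ cong (f zero +_) (sumFin-zero n) ⟩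
  f zero + 0                        ≡⟨ +-identityʳ (f zero) ⟩
  f zero ∎
  where open ≡-Reasoning
sumFin-single {suc n} f (suc a) others =
  trans (cong (_+ sumFin (λ i → f (suc i))) (others zero λ ()))
        (sumFin-single (λ i → f (suc i)) a (λ k k≢a → others (suc k) (k≢a ∘ Fin.suc-injective)))

sumFin-initial : ∀ n a → sumFin {n} (λ k → [ toℕ k <ᵇ a ]) ≡ a ⊓ n
sumFin-initial zero a = sym (⊓-zeroʳ a)
sumFin-initial (suc n) zero = sumFin-zero n
sumFin-initial (suc n) (suc a) = cong suc (sumFin-initial n a)

countFin-≤1 : ∀ {n} (p : Fin n → Bool) → (∀ i k → p i ≡ true → p k ≡ true → i ≡ k) → countFin p ≤ 1
countFin-≤1 {zero} p unique = z≤n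
countFin-≤1 {suc n} p unique with p zero in p0
... | true = ≤-reflexive (cong suc (trans (sumFin-cong rest-false) (sumFin-zero n)))
  where
  rest-false : ∀ i → [ p (suc i) ] ≡ 0
  rest-false i with p (suc i) in pi
  ... | true with () ← unique zero (suc i) p0 pi
  ... | false = refl
... | false = countFin-≤1 (λ i → p (suc i)) (λ i k pi pk → Fin.suc-injective (unique (suc i) (suc k) pi pk))

DownClosed : ∀ {n} → (Fin n → Bool) → Set
DownClosed P = ∀ i k → toℕ i ≤ toℕ k → P k ≡ true → P i ≡ true

downClosed⇒initial : ∀ {n} (P : Fin n → Bool) → DownClosed P → ∀ i → P i ≡ (toℕ i <ᵇ countFin P)
downClosed⇒initial {suc n} P closed i with P zero in P0
downClosed⇒initial {suc n} P closed zero | true = P0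
downClosed⇒initial {suc n} P closed (suc i) | true =
  downClosed⇒initial (λ x → P (suc x)) (λ a b a≤b → closed (suc a) (suc b) (s≤s a≤b)) i
... | false = trans (all-false i) (cong (toℕ i <ᵇ_) (sym (trans (sumFin-cong (cong [_] ∘ all-false ∘ suc)) (sumFin-zero n))))
  where
  all-false : ∀ x → P x ≡ false
  all-false x with P x in Px
  ... | false = refl
  ... | true with () ← trans (sym P0) (closed zero x z≤n Px)

sum≡sumFin : ∀ {r} (v : Vec ℕ r) → sum v ≡ sumFin (lookup v)
sum≡sumFin [] = refl
sum≡sumFin (x ∷ xs) = cong (x +_) (sum≡sumFin xs)

psum≡sumFin : ∀ {r} t (v : Vec ℕ r) → psum t v ≡ sumFin (λ i → if toℕ i <ᵇ t then lookup v i else 0)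
psum≡sumFin {r} zero v = sym (sumFin-zero r)
psum≡sumFin (suc t) [] = refl
psum≡sumFin (suc t) (x ∷ xs) = cong (x +_) (psum≡sumFin t xs)

lookup-ext : ∀ {r} {u v : Vec ℕ r} → (∀ i → lookup u i ≡ lookup v i) → u ≡ v
lookup-ext u≗v = Pointwise-≡⇒≡ (ext u≗v)

module _ {r} (f : Fin r → ℕ) (f-injective : ∀ i k → f i ≡ f k → i ≡ k) where
  private
    below : ℕ → ℕ
    below n = countFin (λ i → f i <ᵇ n)

    below-suc : ∀ n → below (suc n) ≤ below n + 1
    below-suc n = begin
      below (suc n)                               ≡⟨ sumFin-cong (λ i → if-<ᵇ-suc (f i) n 1) ⟩
      sumFin (λ i → [ f i <ᵇ n ] + [ f i ≡ᵇ n ])  ≡⟨ sumFin-+ (λ i → [ f i <ᵇ n ]) (λ i → [ f i ≡ᵇ n ]) ⟩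
      below n + countFin (λ i → f i ≡ᵇ n)         ≤⟨ +-monoʳ-≤ (below n) (countFin-≤1 _ at-most-one) ⟩
      below n + 1                                 ∎
      where
      open ≤-Reasoning
      at-most-one : ∀ i k → (f i ≡ᵇ n) ≡ true → (f k ≡ᵇ n) ≡ true → i ≡ k
      at-most-one i k fi≡n fk≡n = f-injective i k (trans (≡ᵇ-true⁻¹ (f i) n fi≡n) (sym (≡ᵇ-true⁻¹ (f k) n fk≡n)))

    below-+ : ∀ n d → below (n + d) ≤ below n + d
    below-+ n zero = ≤-reflexive (trans (cong below (+-identityʳ n)) (sym (+-identityʳ (below n))))
    below-+ n (suc d) = begin
      below (n + suc d)   ≡⟨ cong below (+-suc n d) ⟩
      below (suc (n + d)) ≤⟨ below-suc (n + d) ⟩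
      below (n + d) + 1   ≤⟨ +-monoˡ-≤ 1 (below-+ n d) ⟩
      below n + d + 1     ≡⟨ trans (+-assoc (below n) d 1) (cong (below n +_) (+-comm d 1)) ⟩
      below n + suc d     ∎
      where open ≤-Reasoning

  -- The count grows by at most one per step and reaches r at r.
  countFin-below-injective : (∀ i → f i < r) → ∀ n → n ≤ r → countFin (λ i → f i <ᵇ n) ≡ n
  countFin-below-injective f<r n n≤r = ≤-antisym at-most-n at-least-n
    where
    open ≤-Reasoning
    at-most-n : below n ≤ n
    at-most-n = ≤-trans (below-+ 0 n) (≤-reflexive (cong (_+ n) (sumFin-zero r)))
    at-least-n : n ≤ below n
    at-least-n = +-cancelʳ-≤ (r ∸ n) n (below n) (begin
      n + (r ∸ n)          ≡⟨ m+[n∸m]≡n n≤r ⟩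
      r                    ≡⟨ sumFin-one r ⟨
      sumFin {r} (λ _ → 1) ≡⟨ sumFin-cong (λ i → cong [_] (<ᵇ-true (f<r i))) ⟨
      below r              ≡⟨ cong below (m+[n∸m]≡n n≤r) ⟨
      below (n + (r ∸ n))  ≤⟨ below-+ n (r ∸ n) ⟩
      below n + (r ∸ n)    ∎)

-- `beats` is the algorithm's `preferred` with `key` in place of `cnt`.
module Ranking {r} (key : Fin r → ℕ) where

  Beats : Fin r → Fin r → Set
  Beats k i = ×-Lex _≡_ _>_ _>_ (key k , toℕ k) (key i , toℕ i)

  beats : Fin r → Fin r → Bool
  beats k i = (key i <ᵇ key k) ∨ ((key k ≡ᵇ key i) ∧ (toℕ i <ᵇ toℕ k))

  beats-reflects : ∀ k i → Reflects (Beats k i) (beats k i)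
  beats-reflects k i = <ᵇ-reflects-< _ _ ⊎-reflects (≡ᵇ-reflects-≡ _ _ ×-reflects <ᵇ-reflects-< _ _)

  Beats⇒key≤ : ∀ {k i} → Beats k i → key i ≤ key k
  Beats⇒key≤ (inj₁ ki<kk) = <⇒≤ ki<kk
  Beats⇒key≤ (inj₂ (kk≡ki , _)) = ≤-reflexive (sym kk≡ki)

  Beats-irrefl : ∀ {i} → ¬ Beats i i
  Beats-irrefl (inj₁ ki<ki) = <-irrefl refl ki<ki
  Beats-irrefl (inj₂ (_ , i<i)) = <-irrefl refl i<i

  Beats-trans : ∀ {a b c} → Beats a b → Beats b c → Beats a c
  Beats-trans = ×-transitive {_≈₁_ = _≡_} {_<₁_ = _>_} {_<₂_ = _>_}
    isEquivalence (resp₂ _>_) (λ x>y y>z → <-trans y>z x>y) (λ x>y y>z → <-trans y>z x>y)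

  Beats-connex : ∀ {i k} → i ≢ k → Beats i k ⊎ Beats k i
  Beats-connex {i} {k} i≢k with <-cmp (key i) (key k)
  ... | tri< ki<kk _ _ = inj₂ (inj₁ ki<kk)
  ... | tri> _ _ kk<ki = inj₁ (inj₁ kk<ki)
  ... | tri≈ _ ki≡kk _ with <-cmp (toℕ i) (toℕ k)
  ...   | tri< i<k _ _ = inj₂ (inj₂ (sym ki≡kk , i<k))
  ...   | tri≈ _ i≡k _ = ⊥-elim (i≢k (Fin.toℕ-injective i≡k))
  ...   | tri> _ _ k<i = inj₁ (inj₂ (ki≡kk , k<i))

  rank : Fin r → ℕ
  rank i = countFin (λ k → beats k i)

  rank-mono : ∀ {k i} → Beats k i → rank k < rank i
  rank-mono {k} {i} k-beats-i = sumFin-mono-< beats-k≤beats-i k k-wins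
    where
    beats-k≤beats-i : ∀ x → [ beats x k ] ≤ [ beats x i ]
    beats-k≤beats-i x with beats x k | beats-reflects x k
    ... | false | _ = z≤n
    ... | true | ofʸ x-beats-k =
      ≤-reflexive (cong [_] (sym (reflects-true (beats-reflects x i) (Beats-trans x-beats-k k-beats-i))))
    k-wins : [ beats k k ] < [ beats k i ]
    k-wins rewrite reflects-false (beats-reflects k k) Beats-irrefl
                 | reflects-true (beats-reflects k i) k-beats-i = s≤s z≤n

  rank<r : ∀ i → rank i < r
  rank<r i = <-≤-trans (sumFin-mono-< (λ x → [ beats x i ]≤1) i self) (≤-reflexive (sumFin-one r))
    where
    self : [ beats i i ] < 1
    self rewrite reflects-false (beats-reflects i i) Beats-irrefl = s≤s z≤n

  rank-injective : ∀ i k → rank i ≡ rank k → i ≡ k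
  rank-injective i k ri≡rk with i Fin.≟ k
  ... | yes i≡k = i≡k
  ... | no i≢k with Beats-connex i≢k
  ...   | inj₁ i-beats-k = ⊥-elim (<-irrefl ri≡rk (rank-mono i-beats-k))
  ...   | inj₂ k-beats-i = ⊥-elim (<-irrefl (sym ri≡rk) (rank-mono k-beats-i))

  selected : ℕ → Fin r → Bool
  selected n i = rank i <ᵇ n

  countFin-selected : ∀ n → n ≤ r → countFin (selected n) ≡ n
  countFin-selected = countFin-below-injective rank rank-injective rank<r

  selected-dominates : ∀ n {a b} → selected n a ≡ true → selected n b ≡ false → key b ≤ key a
  selected-dominates n {a} {b} a-sel b-unsel = ≮⇒≥ λ ka<kb →
    true≢false (trans (sym (<ᵇ-true (<-trans (rank-mono (inj₁ ka<kb)) (<ᵇ-true⁻¹ (rank a) n a-sel)))) b-unsel)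

conj≤r : ∀ {r} (lam : Vec ℕ r) j → conj lam j ≤ r
conj≤r {r} lam j = ≤-trans (sumFin-mono (λ i → [ j <ᵇ lookup lam i ]≤1))
                           (≤-reflexive (sumFin-one r))

m∸1∸n+1≡m∸n : ∀ {m n} → n < m → m ∸ 1 ∸ n + 1 ≡ m ∸ n
m∸1∸n+1≡m∸n {suc m} {n} (s≤s n≤m) = trans (+-comm (m ∸ n) 1) (sym (+-∸-assoc 1 n≤m))

-- With p the number of parts of μ exceeding t:  Σ (μᵢ ∸ t) + p t = psum p μ ≤ psum p λ ≤ Σ (λᵢ ∸ t) + p t.
dominance⇒tailSum≤ : ∀ {r} (lam mu : Vec ℕ r) → IsPartition mu → (∀ t → psum t mu ≤ psum t lam) →
  ∀ t → sumFin (λ i → lookup mu i ∸ t) ≤ sumFin (λ i → lookup lam i ∸ t)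
dominance⇒tailSum≤ {r} lam mu mu-part dom t = +-cancelʳ-≤ pt _ _ (begin
  sumFin (λ i → lookup mu i ∸ t) + pt
    ≡⟨ sumFin-+ (λ i → lookup mu i ∸ t) (λ i → if toℕ i <ᵇ p then t else 0) ⟨
  sumFin (λ i → (lookup mu i ∸ t) + (if toℕ i <ᵇ p then t else 0))
    ≡⟨ sumFin-cong (λ i → long-parts (lookup mu i) _ (downClosed⇒initial long long-closed i)) ⟩
  sumFin (λ i → if toℕ i <ᵇ p then lookup mu i else 0)
    ≡⟨ psum≡sumFin p mu ⟨
  psum p mu
    ≤⟨ dom p ⟩
  psum p lam
    ≡⟨ psum≡sumFin p lam ⟩
  sumFin (λ i → if toℕ i <ᵇ p then lookup lam i else 0)
    ≤⟨ sumFin-mono (λ i → ≤-split (lookup lam i) (toℕ i <ᵇ p)) ⟩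
  sumFin (λ i → (lookup lam i ∸ t) + (if toℕ i <ᵇ p then t else 0))
    ≡⟨ sumFin-+ (λ i → lookup lam i ∸ t) (λ i → if toℕ i <ᵇ p then t else 0) ⟩
  sumFin (λ i → lookup lam i ∸ t) + pt ∎)
  where
  open ≤-Reasoning
  long : Fin r → Bool
  long i = t <ᵇ lookup mu i
  long-closed : DownClosed long
  long-closed i k i≤k long-k = <ᵇ-true (≤-trans (<ᵇ-true⁻¹ t (lookup mu k) long-k) (mu-part i k i≤k))
  p : ℕ
  p = countFin long
  pt : ℕ
  pt = sumFin (λ (i : Fin r) → if toℕ i <ᵇ p then t else 0)
  long-parts : ∀ x b → (t <ᵇ x) ≡ b → (x ∸ t) + (if b then t else 0) ≡ (if b then x else 0)
  long-parts x true t<x = m∸n+n≡m (<⇒≤ (<ᵇ-true⁻¹ t x t<x))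
  long-parts x false x≤t = cong (_+ 0) (m≤n⇒m∸n≡0 (<ᵇ-false⁻¹ t x x≤t))
  ≤-split : ∀ x b → (if b then x else 0) ≤ (x ∸ t) + (if b then t else 0)
  ≤-split x true = ≤-trans (m≤n+m∸n x t) (≤-reflexive (+-comm t (x ∸ t)))
  ≤-split x false = z≤n

module Boxes {r} (lam : Vec ℕ r) where

  -- The number of boxes of the Young diagram of λ in the (0-indexed) columns t, …, u − 1.
  boxesBetween : ℕ → ℕ → ℕ
  boxesBetween t u = sumFin (λ i → (lookup lam i ⊓ u) ∸ t)

  boxesBetween-suc : ∀ t j → t ≤ j → boxesBetween t (suc j) ≡ boxesBetween t j + conj lam j
  boxesBetween-suc t j t≤j = trans (sumFin-cong (λ i → row (lookup lam i)))
                                   (sumFin-+ (λ i → (lookup lam i ⊓ j) ∸ t) (λ i → [ j <ᵇ lookup lam i ]))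
    where
    row : ∀ x → (x ⊓ suc j) ∸ t ≡ ((x ⊓ j) ∸ t) + [ j <ᵇ x ]
    row x with j <ᵇ x | <ᵇ-reflects-< j x
    ... | true | ofʸ j<x rewrite m≥n⇒m⊓n≡n j<x | m≥n⇒m⊓n≡n (<⇒≤ j<x) =
      trans (+-∸-assoc 1 t≤j) (+-comm 1 (j ∸ t))
    ... | false | ofⁿ j≮x rewrite m≤n⇒m⊓n≡m (≮⇒≥ j≮x) | m≤n⇒m⊓n≡m (m≤n⇒m≤1+n (≮⇒≥ j≮x)) =
      sym (+-identityʳ _)

  boxesBetween-self : ∀ j → boxesBetween j j ≡ 0
  boxesBetween-self j = trans (sumFin-cong (λ i → m≤n⇒m∸n≡0 (m⊓n≤n (lookup lam i) j))) (sumFin-zero r)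

  -- Each of the λ′ⱼ rows longer than j has all its v ∸ t boxes between t and v.
  boxesBetween-≥ : ∀ t v j → v ≤ suc j → (v ∸ t) * conj lam j ≤ boxesBetween t v
  boxesBetween-≥ t v j v≤1+j = begin
    (v ∸ t) * conj lam j                           ≡⟨ sumFin-* (v ∸ t) (λ i → [ j <ᵇ lookup lam i ]) ⟨
    sumFin (λ i → (v ∸ t) * [ j <ᵇ lookup lam i ]) ≤⟨ sumFin-mono (λ i → row (lookup lam i)) ⟩
    boxesBetween t v                               ∎
    where
    open ≤-Reasoning
    row : ∀ x → (v ∸ t) * [ j <ᵇ x ] ≤ (x ⊓ v) ∸ t
    row x with j <ᵇ x | <ᵇ-reflects-< j x
    ... | true | ofʸ j<x rewrite m≥n⇒m⊓n≡n (≤-trans v≤1+j j<x) | *-identityʳ (v ∸ t) = ≤-refl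
    ... | false | _ rewrite *-zeroʳ (v ∸ t) = z≤n

  -- The row lengths c, viewed as a shape, are majorized by λ cut off after u columns.
  record Majorized (u : ℕ) (c : Fin r → ℕ) : Set where
    field
      bounded : ∀ i → c i ≤ u
      total : sumFin c ≡ boxesBetween 0 u
      tails : ∀ t → t ≤ u → sumFin (λ i → c i ∸ t) ≤ boxesBetween t u

  module ColumnStep (j : ℕ) (c : Fin r → ℕ) (maj : Majorized (suc j) c) where
    open Majorized maj
    open Ranking c public

    n : ℕ
    n = conj lam j

    countFin-selected-n : countFin (selected n) ≡ n
    countFin-selected-n = countFin-selected n (conj≤r lam j)

    -- Every row beating a full row is full, and there are at most λ′ⱼ full rows.
    full⇒selected : ∀ i → c i ≡ suc j → selected n i ≡ true
    full⇒selected i ci≡1+j = <ᵇ-true (<-≤-trans (sumFin-mono-< beaters-full i self) full-rows≤n)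
      where
      full-rows≤n : sumFin (λ k → c k ∸ j) ≤ n
      full-rows≤n = ≤-trans (tails j (n≤1+n j))
        (≤-reflexive (trans (boxesBetween-suc j j ≤-refl) (cong (_+ n) (boxesBetween-self j))))
      beaters-full : ∀ k → [ beats k i ] ≤ c k ∸ j
      beaters-full k with beats k i | beats-reflects k i
      ... | false | _ = z≤n
      ... | true | ofʸ k-beats-i = m<n⇒0<n∸m (≤-trans (≤-reflexive (sym ci≡1+j)) (Beats⇒key≤ k-beats-i))
      self : [ beats i i ] < c i ∸ j
      self rewrite reflects-false (beats-reflects i i) Beats-irrefl | ci≡1+j = m<n⇒0<n∸m (n<1+n j)

    -- An empty selected row would leave the unselected rows empty too, so Σ c < (j+1) λ′ⱼ.
    selected⇒nonempty : ∀ a → selected n a ≡ true → 1 ≤ c a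
    selected⇒nonempty a a-sel = n≢0⇒n>0 a-nonempty
      where
      a-nonempty : c a ≢ 0
      a-nonempty ca≡0 = <⇒≱ (<-≤-trans (sumFin-mono-< bound a strict) (≤-reflexive sum-bound)) large
        where
        bound : ∀ i → c i ≤ suc j * [ selected n i ]
        bound i with selected n i in i-sel
        ... | true = ≤-trans (bounded i) (≤-reflexive (sym (*-identityʳ (suc j))))
        ... | false = ≤-trans (selected-dominates n a-sel i-sel) (≤-reflexive (trans ca≡0 (sym (*-zeroʳ (suc j)))))
        strict : c a < suc j * [ selected n a ]
        strict = subst₂ _<_ (sym ca≡0) (sym (trans (cong (λ b → suc j * [ b ]) a-sel) (*-identityʳ (suc j)))) (s≤s z≤n)
        sum-bound : sumFin (λ i → suc j * [ selected n i ]) ≡ suc j * n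
        sum-bound = trans (sumFin-* (suc j) (λ i → [ selected n i ])) (cong (suc j *_) countFin-selected-n)
        large : suc j * n ≤ sumFin c
        large = ≤-trans (boxesBetween-≥ 0 (suc j) j ≤-refl) (≤-reflexive (sym total))

    shrunk : Fin r → ℕ
    shrunk i = c i ∸ [ selected n i ]

    shrunk+[selected] : ∀ i → shrunk i + [ selected n i ] ≡ c i
    shrunk+[selected] i with selected n i in i-sel
    ... | true = m∸n+n≡m (selected⇒nonempty i i-sel)
    ... | false = +-identityʳ (c i)

    shrunk-bounded : ∀ i → shrunk i ≤ j
    shrunk-bounded i with selected n i in i-sel
    ... | true = ∸-monoˡ-≤ 1 (bounded i)
    ... | false = ≤-pred (≤∧≢⇒< (bounded i) (λ full → true≢false (trans (sym (full⇒selected i full)) i-sel)))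

    shrunk-total : sumFin shrunk ≡ boxesBetween 0 j
    shrunk-total = +-cancelʳ-≡ n (sumFin shrunk) (boxesBetween 0 j) (begin
      sumFin shrunk + n                            ≡⟨ cong (sumFin shrunk +_) countFin-selected-n ⟨
      sumFin shrunk + countFin (selected n)        ≡⟨ sumFin-+ shrunk (λ i → [ selected n i ]) ⟨
      sumFin (λ i → shrunk i + [ selected n i ])   ≡⟨ sumFin-cong shrunk+[selected] ⟩
      sumFin c                                     ≡⟨ total ⟩
      boxesBetween 0 (suc j)                       ≡⟨ boxesBetween-suc 0 j z≤n ⟩
      boxesBetween 0 j + n                         ∎)
      where open ≡-Reasoning

    -- If some selected row ends by column t, every unselected row does too.
    shrunk-tails-short : ∀ t a → selected n a ≡ true → c a ≤ t → sumFin (λ i → shrunk i ∸ t) ≤ boxesBetween t j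
    shrunk-tails-short t a a-sel ca≤t = begin
      sumFin (λ i → shrunk i ∸ t)                  ≤⟨ sumFin-mono row ⟩
      sumFin (λ i → (j ∸ t) * [ selected n i ])    ≡⟨ sumFin-* (j ∸ t) (λ i → [ selected n i ]) ⟩
      (j ∸ t) * countFin (selected n)              ≡⟨ cong ((j ∸ t) *_) countFin-selected-n ⟩
      (j ∸ t) * n                                  ≤⟨ boxesBetween-≥ t j j (n≤1+n j) ⟩
      boxesBetween t j                             ∎
      where
      open ≤-Reasoning
      row : ∀ i → shrunk i ∸ t ≤ (j ∸ t) * [ selected n i ]
      row i with selected n i in i-sel | shrunk-bounded i
      ... | true | shrunk≤j rewrite *-identityʳ (j ∸ t) = ∸-monoˡ-≤ t shrunk≤j
      ... | false | _ rewrite *-zeroʳ (j ∸ t) =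
        ≤-reflexive (m≤n⇒m∸n≡0 (≤-trans (selected-dominates n a-sel i-sel) ca≤t))

    -- Otherwise removing one box from each selected row lowers the tail sum by exactly λ′ⱼ.
    shrunk-tails-long : ∀ t → t ≤ j → (∀ a → selected n a ≡ true → t < c a) →
                        sumFin (λ i → shrunk i ∸ t) ≤ boxesBetween t j
    shrunk-tails-long t t≤j long = +-cancelʳ-≤ n _ _ (begin
      sumFin (λ i → shrunk i ∸ t) + n                      ≡⟨ cong (sumFin (λ i → shrunk i ∸ t) +_) countFin-selected-n ⟨
      sumFin (λ i → shrunk i ∸ t) + countFin (selected n)  ≡⟨ sumFin-+ (λ i → shrunk i ∸ t) (λ i → [ selected n i ]) ⟨
      sumFin (λ i → (shrunk i ∸ t) + [ selected n i ])     ≡⟨ sumFin-cong row ⟩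
      sumFin (λ i → c i ∸ t)                               ≤⟨ tails t (m≤n⇒m≤1+n t≤j) ⟩
      boxesBetween t (suc j)                               ≡⟨ boxesBetween-suc t j t≤j ⟩
      boxesBetween t j + n                                 ∎)
      where
      open ≤-Reasoning
      row : ∀ i → (shrunk i ∸ t) + [ selected n i ] ≡ c i ∸ t
      row i with selected n i in i-sel
      ... | true = m∸1∸n+1≡m∸n (long i i-sel)
      ... | false = +-identityʳ _

    shrunk-majorized : Majorized j shrunk
    shrunk-majorized = record { bounded = shrunk-bounded ; total = shrunk-total ; tails = tails' }
      where
      tails' : ∀ t → t ≤ j → sumFin (λ i → shrunk i ∸ t) ≤ boxesBetween t j
      tails' t t≤j with Fin.any? (λ a → (selected n a Bool.≟ true) ×-dec (c a ≤? t))
      ... | yes (a , a-sel , ca≤t) = shrunk-tails-short t a a-sel ca≤t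
      ... | no none-short = shrunk-tails-long t t≤j (λ a a-sel → ≰⇒> (λ ca≤t → none-short (a , a-sel , ca≤t)))

∧-true⁻¹ : ∀ {a b} → a ∧ b ≡ true → a ≡ true × b ≡ true
∧-true⁻¹ {true} b≡true = refl , b≡true

allFinB-intro : ∀ {n} (p : Fin n → Bool) → (∀ a → p a ≡ true) → allFinB p ≡ true
allFinB-intro {zero} p all = refl
allFinB-intro {suc n} p all rewrite all zero = allFinB-intro (λ i → p (suc i)) (λ a → all (suc a))

allFinB-elim : ∀ {n} (p : Fin n → Bool) → allFinB p ≡ true → ∀ a → p a ≡ true
allFinB-elim p all zero = proj₁ (∧-true⁻¹ all)
allFinB-elim p all (suc a) = allFinB-elim (λ i → p (suc i)) (proj₂ (∧-true⁻¹ {p zero} all)) a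

anyFinB-intro : ∀ {n} (p : Fin n → Bool) a → p a ≡ true → anyFinB p ≡ true
anyFinB-intro p zero pa rewrite pa = refl
anyFinB-intro p (suc a) pa with p zero
... | true = refl
... | false = anyFinB-intro (λ i → p (suc i)) a pa

sumFin-below-suc : ∀ {s} (f : Fin s → ℕ) {j} (k₀ : Fin s) → toℕ k₀ ≡ j →
  sumFin (λ k → if toℕ k <ᵇ suc j then f k else 0) ≡ sumFin (λ k → if toℕ k <ᵇ j then f k else 0) + f k₀
sumFin-below-suc f {j} k₀ k₀≡j = begin
  sumFin (λ k → if toℕ k <ᵇ suc j then f k else 0)
    ≡⟨ sumFin-cong (λ k → if-<ᵇ-suc (toℕ k) j (f k)) ⟩
  sumFin (λ k → (if toℕ k <ᵇ j then f k else 0) + (if toℕ k ≡ᵇ j then f k else 0))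
    ≡⟨ sumFin-+ (λ k → if toℕ k <ᵇ j then f k else 0) (λ k → if toℕ k ≡ᵇ j then f k else 0) ⟩
  sumFin (λ k → if toℕ k <ᵇ j then f k else 0) + sumFin (λ k → if toℕ k ≡ᵇ j then f k else 0)
    ≡⟨ cong (sumFin (λ k → if toℕ k <ᵇ j then f k else 0) +_) (sumFin-single _ k₀ others) ⟩
  sumFin (λ k → if toℕ k <ᵇ j then f k else 0) + (if toℕ k₀ ≡ᵇ j then f k₀ else 0)
    ≡⟨ cong (λ b → sumFin (λ k → if toℕ k <ᵇ j then f k else 0) + (if b then f k₀ else 0)) (≡ᵇ-true k₀≡j) ⟩
  sumFin (λ k → if toℕ k <ᵇ j then f k else 0) + f k₀ ∎
  where
  open ≡-Reasoning
  others : ∀ k → k ≢ k₀ → (if toℕ k ≡ᵇ j then f k else 0) ≡ 0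
  others k k≢k₀ rewrite ≡ᵇ-false (λ k≡j → k≢k₀ (Fin.toℕ-injective (trans k≡j (sym k₀≡j)))) = refl

module Simulation {r s : ℕ} (lam : Vec ℕ r) where
  open Boxes lam

  LeftJustified : ℕ → Matrix r s → (Fin r → ℕ) → Set
  LeftJustified u M c = ∀ i k → toℕ k < u → M i k ≡ [ toℕ k <ᵇ c i ]

  module AlgorithmStep (j : ℕ) (M : Matrix r s) (c : Fin r → ℕ) (j<s : j < s)
                       (justified : LeftJustified (suc j) M c) (maj : Majorized (suc j) c) where
    open Majorized maj
    open ColumnStep j c maj public

    cnt≡c : ∀ i → cnt n j M i ≡ c i
    cnt≡c i = trans (sumFin-cong entry) (trans (sumFin-initial s (c i)) (m≤n⇒m⊓n≡m (≤-trans (bounded i) j<s)))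
      where
      entry : ∀ k → (if toℕ k <ᵇ suc j then M i k else 0) ≡ [ toℕ k <ᵇ c i ]
      entry k with toℕ k <ᵇ suc j | <ᵇ-reflects-< (toℕ k) (suc j)
      ... | true | ofʸ k≤j = justified i k k≤j
      ... | false | ofⁿ k≰j = cong [_] (sym (<ᵇ-false (≤-trans (bounded i) (≮⇒≥ k≰j))))

    chosen≡selected : ∀ i → chosen n j M i ≡ selected n i
    chosen≡selected i = cong (_<ᵇ n) (sumFin-cong (λ k → cong [_] (cong₂ (lexᵇ k) (cnt≡c k) (cnt≡c i))))
      where
      lexᵇ : Fin r → ℕ → ℕ → Bool
      lexᵇ k a b = (b <ᵇ a) ∨ ((a ≡ᵇ b) ∧ (toℕ i <ᵇ toℕ k))

    private
      laterCellEmpty : Fin r → Fin s → Fin s → Bool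
      laterCellEmpty i k k′ = not ((toℕ k <ᵇ toℕ k′) ∧ inRange n j M k′) ∨ (M i k′ ≡ᵇ 0)

    rightmost : ∀ i k → suc (toℕ k) ≡ c i → isRightmostOne n j M i k ≡ true
    rightmost i k 1+k≡ci =
      cong₂ _∧_ (cong (_≡ᵇ 1) (trans (justified i k k<1+j) (cong [_] (<ᵇ-true k<ci))))
                (cong₂ _∧_ (<ᵇ-true k<1+j) (allFinB-intro (laterCellEmpty i k) no-later-one))
      where
      k<ci : toℕ k < c i
      k<ci = ≤-reflexive 1+k≡ci
      k<1+j : toℕ k < suc j
      k<1+j = ≤-trans k<ci (bounded i)
      no-later-one : ∀ k′ → laterCellEmpty i k k′ ≡ true
      no-later-one k′ with toℕ k <ᵇ toℕ k′ | <ᵇ-reflects-< (toℕ k) (toℕ k′)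
      ... | false | _ = refl
      ... | true | ofʸ k<k′ with toℕ k′ <ᵇ suc j | <ᵇ-reflects-< (toℕ k′) (suc j)
      ...   | false | _ = refl
      ...   | true | ofʸ k′≤j rewrite justified i k′ k′≤j | <ᵇ-false (≤-trans (≤-reflexive (sym 1+k≡ci)) k<k′) = refl

    rightmost⁻¹ : ∀ i k → isRightmostOne n j M i k ≡ true → suc (toℕ k) ≡ c i
    rightmost⁻¹ i k rm = ≤-antisym k<ci (≮⇒≥ no-one-after)
      where
      one : M i k ≡ 1
      one = ≡ᵇ-true⁻¹ (M i k) 1 (proj₁ (∧-true⁻¹ rm))
      k≤j : toℕ k < suc j
      k≤j = <ᵇ-true⁻¹ (toℕ k) (suc j) (proj₁ (∧-true⁻¹ (proj₂ (∧-true⁻¹ {M i k ≡ᵇ 1} rm))))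
      no-later-one : allFinB (laterCellEmpty i k) ≡ true
      no-later-one = proj₂ (∧-true⁻¹ (proj₂ (∧-true⁻¹ {M i k ≡ᵇ 1} rm)))
      k<ci : toℕ k < c i
      k<ci = <ᵇ-true⁻¹ (toℕ k) (c i) ([b]≡1⇒b (trans (sym (justified i k k≤j)) one))
        where
        [b]≡1⇒b : ∀ {b} → [ b ] ≡ 1 → b ≡ true
        [b]≡1⇒b {true} _ = refl
      no-one-after : suc (toℕ k) ≮ c i
      no-one-after 2+k≤ci = true≢false (trans (sym (allFinB-elim (laterCellEmpty i k) no-later-one k′)) laterCellEmpty-false)
        where
        k′<s : suc (toℕ k) < s
        k′<s = ≤-trans 2+k≤ci (≤-trans (bounded i) j<s)
        k′ : Fin s
        k′ = fromℕ< k′<s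
        k′≡1+k : toℕ k′ ≡ suc (toℕ k)
        k′≡1+k = Fin.toℕ-fromℕ< k′<s
        k′<ci : toℕ k′ < c i
        k′<ci = subst (_< c i) (sym k′≡1+k) 2+k≤ci
        laterCellEmpty-false : laterCellEmpty i k k′ ≡ false
        laterCellEmpty-false rewrite <ᵇ-true (≤-reflexive (sym k′≡1+k)) | <ᵇ-true (≤-trans k′<ci (bounded i))
                           | justified i k′ (≤-trans k′<ci (bounded i)) | <ᵇ-true k′<ci = refl

    hasOne-selected : ∀ i → selected n i ≡ true → hasOne n j M i ≡ true
    hasOne-selected i i-sel = anyFinB-intro (isRightmostOne n j M i) last (rightmost i last 1+last≡ci)
      where
      ci≥1 : 1 ≤ c i
      ci≥1 = selected⇒nonempty i i-sel
      ci∸1<s : c i ∸ 1 < s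
      ci∸1<s = <-≤-trans (∸-monoʳ-< {o = 0} ≤-refl ci≥1) (≤-trans (bounded i) j<s)
      last : Fin s
      last = fromℕ< ci∸1<s
      1+last≡ci : suc (toℕ last) ≡ c i
      1+last≡ci = trans (cong suc (Fin.toℕ-fromℕ< ci∸1<s)) (trans (+-comm 1 (c i ∸ 1)) (m∸n+n≡m ci≥1))

    rightmostRemoved : Fin r → Fin s → ℕ
    rightmostRemoved i k = if isRightmostOne n j M i k then 0 else M i k

    moved : Fin r → Fin s → ℕ
    moved i k = if toℕ k ≡ᵇ j then 1 else rightmostRemoved i k

    step-selected : ∀ i k → selected n i ≡ true → step n j M i k ≡ moved i k
    step-selected i k i-sel =
      cong (λ b → if b then moved i k else M i k)
           (cong₂ _∧_ (trans (chosen≡selected i) i-sel) (hasOne-selected i i-sel))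

    step-unselected : ∀ i k → selected n i ≡ false → step n j M i k ≡ M i k
    step-unselected i k i-unsel =
      cong (λ b → if b ∧ hasOne n j M i then moved i k else M i k) (trans (chosen≡selected i) i-unsel)

    step-column : ∀ i k → toℕ k ≡ j → step n j M i k ≡ [ selected n i ]
    step-column i k k≡j with selected n i in i-sel
    ... | true = trans (step-selected i k i-sel) (cong (λ b → if b then 1 else rightmostRemoved i k) (≡ᵇ-true k≡j))
    ... | false = begin
      step n j M i k         ≡⟨ step-unselected i k i-sel ⟩
      M i k                  ≡⟨ justified i k (≤-reflexive (cong suc k≡j)) ⟩
      [ toℕ k <ᵇ c i ]       ≡⟨ cong [_] (<ᵇ-false (subst (c i ≤_) (sym k≡j) ci≤j)) ⟩
      0                      ∎
      where
      open ≡-Reasoning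
      ci≤j : c i ≤ j
      ci≤j = subst (λ b → c i ∸ [ b ] ≤ j) i-sel (shrunk-bounded i)

    step-justified : LeftJustified j (step n j M) shrunk
    step-justified i k k<j with selected n i in i-sel
    ... | false = trans (step-unselected i k i-sel) (justified i k (m≤n⇒m≤1+n k<j))
    ... | true = begin
      step n j M i k         ≡⟨ step-selected i k i-sel ⟩
      moved i k              ≡⟨ cong (λ b → if b then 1 else rightmostRemoved i k) (≡ᵇ-false (<⇒≢ k<j)) ⟩
      rightmostRemoved i k   ≡⟨ drop-last ⟩
      [ toℕ k <ᵇ c i ∸ 1 ]   ∎
      where
      open ≡-Reasoning
      drop-last : rightmostRemoved i k ≡ [ toℕ k <ᵇ c i ∸ 1 ]
      drop-last with isRightmostOne n j M i k in rm
      ... | true = cong [_] (sym (<ᵇ-false (≤-reflexive (cong (_∸ 1) (sym (rightmost⁻¹ i k rm))))))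
      ... | false = trans (justified i k (m≤n⇒m≤1+n k<j))
                          (cong [_] (<ᵇ-pred (toℕ k) (c i) (λ 1+k≡ci → true≢false (trans (sym (rightmost i k 1+k≡ci)) rm))))

    step-beyond : ∀ i k → suc j ≤ toℕ k → step n j M i k ≡ M i k
    step-beyond i k j<k with selected n i in i-sel
    ... | false = step-unselected i k i-sel
    ... | true = begin
      step n j M i k         ≡⟨ step-selected i k i-sel ⟩
      moved i k              ≡⟨ cong (λ b → if b then 1 else rightmostRemoved i k) (≡ᵇ-false (>⇒≢ j<k)) ⟩
      rightmostRemoved i k   ≡⟨ cong (λ b → if b then 0 else M i k) not-rightmost ⟩
      M i k                  ∎
      where
      open ≡-Reasoning
      not-rightmost : isRightmostOne n j M i k ≡ false
      not-rightmost with isRightmostOne n j M i k in rm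
      ... | false = refl
      ... | true = ⊥-elim (<⇒≱ j<k (≤-pred (subst (_≤ suc j) (sym (rightmost⁻¹ i k rm)) (bounded i))))

  record Processed (u : ℕ) (M R : Matrix r s) (c : Fin r → ℕ) : Set where
    field
      unchanged : ∀ i k → u ≤ toℕ k → R i k ≡ M i k
      entry≤1 : ∀ i k → toℕ k < u → R i k ≤ 1
      columnSum : ∀ k → toℕ k < u → sumFin (λ i → R i k) ≡ conj lam (toℕ k)
      rowSum : ∀ i → sumFin (λ k → if toℕ k <ᵇ u then R i k else 0) ≡ c i

  runSteps-processed : ∀ u M c → u ≤ s → LeftJustified u M c → Majorized u c →
                       Processed u M (runSteps lam u M) c
  runSteps-processed zero M c _ _ maj = record
    { unchanged = λ _ _ _ → refl
    ; entry≤1 = λ _ _ ()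
    ; columnSum = λ _ ()
    ; rowSum = λ i → trans (sumFin-zero s) (sym (n≤0⇒n≡0 (Majorized.bounded maj i))) }
  runSteps-processed (suc j) M c j<s justified maj = record
    { unchanged = λ i k j<k → trans (unchanged i k (<⇒≤ j<k)) (step-beyond i k j<k)
    ; entry≤1 = entry≤1′
    ; columnSum = columnSum′
    ; rowSum = rowSum′ }
    where
    open AlgorithmStep j M c j<s justified maj
    R : Matrix r s
    R = runSteps lam j (step n j M)
    open Processed (runSteps-processed j (step n j M) shrunk (<⇒≤ j<s) step-justified shrunk-majorized)

    column-j : ∀ i k → toℕ k ≡ j → R i k ≡ [ selected n i ]
    column-j i k k≡j = trans (unchanged i k (≤-reflexive (sym k≡j))) (step-column i k k≡j)

    entry≤1′ : ∀ i k → toℕ k < suc j → R i k ≤ 1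
    entry≤1′ i k k≤j with m≤n⇒m<n∨m≡n (≤-pred k≤j)
    ... | inj₁ k<j = entry≤1 i k k<j
    ... | inj₂ k≡j = subst (_≤ 1) (sym (column-j i k k≡j)) [ selected n i ]≤1

    columnSum′ : ∀ k → toℕ k < suc j → sumFin (λ i → R i k) ≡ conj lam (toℕ k)
    columnSum′ k k≤j with m≤n⇒m<n∨m≡n (≤-pred k≤j)
    ... | inj₁ k<j = columnSum k k<j
    ... | inj₂ k≡j = trans (sumFin-cong (λ i → column-j i k k≡j)) (trans countFin-selected-n (cong (conj lam) (sym k≡j)))

    rowSum′ : ∀ i → sumFin (λ k → if toℕ k <ᵇ suc j then R i k else 0) ≡ c i
    rowSum′ i = begin
      sumFin (λ k → if toℕ k <ᵇ suc j then R i k else 0)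
        ≡⟨ sumFin-below-suc (R i) (fromℕ< j<s) (Fin.toℕ-fromℕ< j<s) ⟩
      sumFin (λ k → if toℕ k <ᵇ j then R i k else 0) + R i (fromℕ< j<s)
        ≡⟨ cong₂ _+_ (rowSum i) (column-j i _ (Fin.toℕ-fromℕ< j<s)) ⟩
      shrunk i + [ selected n i ]
        ≡⟨ shrunk+[selected] i ⟩
      c i ∎
      where open ≡-Reasoning

record RyserMatrix {r s} (lam mu : Vec ℕ r) (A : Matrix r s) : Set where
  field
    entry≤1 : ∀ i k → A i k ≤ 1
    columnSum : ∀ k → sumFin (λ i → A i k) ≡ conj lam (toℕ k)
    rowSum : ∀ i → sumFin (A i) ≡ lookup mu i

canonical-ryser : ∀ {r} (lam mu : Vec ℕ r) → InKostka lam mu → RyserMatrix lam mu (canonical lam mu)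
canonical-ryser [] [] _ = record { entry≤1 = λ () ; columnSum = λ () ; rowSum = λ () }
canonical-ryser lam@(l ∷ _) mu@(_ ∷ _) (lam-part , mu-part , sum≡ , dom) = record
  { entry≤1 = λ i k → entry≤1 i k (Fin.toℕ<n k)
  ; columnSum = λ k → columnSum k (Fin.toℕ<n k)
  ; rowSum = λ i → trans (sumFin-cong (λ k → cong (λ b → if b then canonical lam mu i k else 0)
                                                  (sym (<ᵇ-true (Fin.toℕ<n k)))))
                         (rowSum i)
  }
  where
  open Boxes lam
  open Simulation {s = l} lam
  parts≤l : ∀ i → lookup lam i ⊓ l ≡ lookup lam i
  parts≤l i = m≤n⇒m⊓n≡m (lam-part zero i z≤n)
  initial : Majorized l (lookup mu)
  initial = record
    { bounded = λ i → ≤-trans (mu-part zero i z≤n) (subst₂ _≤_ (+-identityʳ _) (+-identityʳ l) (dom 1))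
    ; total = trans (sym (sum≡sumFin mu)) (trans (sym sum≡) (trans (sum≡sumFin lam) (sumFin-cong (sym ∘ parts≤l))))
    ; tails = λ t _ → ≤-trans (dominance⇒tailSum≤ lam mu mu-part dom t)
                              (≤-reflexive (sumFin-cong (λ i → cong (_∸ t) (sym (parts≤l i)))))
    }
  open Processed (runSteps-processed l (initMatrix mu) (lookup mu) ≤-refl (λ _ _ _ → refl) initial)

sum-replicate-zero : ∀ r → sum (replicate r 0) ≡ 0
sum-replicate-zero zero = refl
sum-replicate-zero (suc r) = sum-replicate-zero r

sumFin-initial-⊓ : ∀ r t x → x ≤ r → sumFin {r} (λ i → if toℕ i <ᵇ t then [ toℕ i <ᵇ x ] else 0) ≡ t ⊓ x
sumFin-initial-⊓ r t x x≤r =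
  trans (sumFin-cong {r} (λ i → cell (toℕ i)))
        (trans (sumFin-initial r (t ⊓ x)) (m≤n⇒m⊓n≡m (≤-trans (m⊓n≤n t x) x≤r)))
  where
  cell : ∀ a → (if a <ᵇ t then [ a <ᵇ x ] else 0) ≡ [ a <ᵇ t ⊓ x ]
  cell a with a <ᵇ t | <ᵇ-reflects-< a t | a <ᵇ x | <ᵇ-reflects-< a x
  ... | true | ofʸ a<t | true | ofʸ a<x = cong [_] (sym (<ᵇ-true (⊓-glb a<t a<x)))
  ... | true | _ | false | ofⁿ a≮x = cong [_] (sym (<ᵇ-false (≤-trans (m⊓n≤n t x) (≮⇒≥ a≮x))))
  ... | false | ofⁿ a≮t | _ | _ = cong [_] (sym (<ᵇ-false (≤-trans (m⊓n≤m t x) (≮⇒≥ a≮t))))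

sumFin-initial≤⊓ : ∀ {r} (f : Fin r → ℕ) → (∀ i → f i ≤ 1) → ∀ t →
  sumFin (λ i → if toℕ i <ᵇ t then f i else 0) ≤ t ⊓ sumFin f
sumFin-initial≤⊓ {r} f f≤1 t = ⊓-glb (≤-trans (sumFin-mono (λ i → ≤-[] (toℕ i <ᵇ t) i)) at-most-t)
                                    (sumFin-mono (λ i → ≤-f (toℕ i <ᵇ t) i))
  where
  ≤-[] : ∀ b i → (if b then f i else 0) ≤ [ b ]
  ≤-[] true i = f≤1 i
  ≤-[] false i = z≤n
  ≤-f : ∀ b i → (if b then f i else 0) ≤ f i
  ≤-f true i = ≤-refl
  ≤-f false i = z≤n
  at-most-t : sumFin (λ (i : Fin r) → [ toℕ i <ᵇ t ]) ≤ t
  at-most-t = ≤-trans (≤-reflexive (sumFin-initial r t)) (m⊓n≤m t r)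

colSum-swap : ∀ {r s} (h : Matrix r s) T → sumFin (colSum h T) ≡ sumFin (λ k → if T k then sumFin (λ i → h i k) else 0)
colSum-swap h T = trans (sumFin-swap (λ i k → if T k then h i k else 0))
                        (sumFin-cong (λ k → sumFin-if (T k) (λ i → h i k)))

module _ {r s : ℕ} (h : Matrix r s) where

  sum-colSum : ∀ T → sum (tabulate (colSum h T)) ≡ sumFin (λ k → if T k then sumFin (λ i → h i k) else 0)
  sum-colSum T = trans (sum≡sumFin (tabulate (colSum h T))) (trans (sumFin-cong (lookup∘tabulate (colSum h T))) (colSum-swap h T))

  psum-colSum : ∀ t T → psum t (tabulate (colSum h T)) ≡
    sumFin (λ k → if T k then sumFin (λ i → if toℕ i <ᵇ t then h i k else 0) else 0)
  psum-colSum t T = begin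
    psum t (tabulate (colSum h T))
      ≡⟨ psum≡sumFin t (tabulate (colSum h T)) ⟩
    sumFin (λ i → if toℕ i <ᵇ t then lookup (tabulate (colSum h T)) i else 0)
      ≡⟨ sumFin-cong (λ i → cong (λ x → if toℕ i <ᵇ t then x else 0) (lookup∘tabulate (colSum h T) i)) ⟩
    sumFin (λ i → if toℕ i <ᵇ t then colSum h T i else 0)
      ≡⟨ sumFin-cong (λ i → trans (sym (sumFin-if (toℕ i <ᵇ t) (λ k → if T k then h i k else 0)))
                                  (sumFin-cong (λ k → if-swap (toℕ i <ᵇ t) (T k) (h i k)))) ⟩
    sumFin (colSum (λ i k → if toℕ i <ᵇ t then h i k else 0) T)
      ≡⟨ colSum-swap (λ i k → if toℕ i <ᵇ t then h i k else 0) T ⟩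
    sumFin (λ k → if T k then sumFin (λ i → if toℕ i <ᵇ t then h i k else 0) else 0) ∎
    where
    open ≡-Reasoning
    if-swap : ∀ a b x → (if a then (if b then x else 0) else 0) ≡ (if b then (if a then x else 0) else 0)
    if-swap true b x = refl
    if-swap false true x = refl
    if-swap false false x = refl

  colSum-complement : ∀ T i → colSum h T i + colSum h (not ∘ T) i ≡ sumFin (h i)
  colSum-complement T i = trans (sym (sumFin-+ (λ k → if T k then h i k else 0) (λ k → if not (T k) then h i k else 0)))
                                (sumFin-cong (λ k → complement (T k) (h i k)))
    where
    complement : ∀ b x → (if b then x else 0) + (if not b then x else 0) ≡ x
    complement true x = +-identityʳ x
    complement false x = refl

  tabulate-colSum-complement : ∀ T →
    zipWith _+_ (tabulate (colSum h T)) (tabulate (colSum h (not ∘ T))) ≡ tabulate (λ i → sumFin (h i))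
  tabulate-colSum-complement T = lookup-ext λ i → begin
    lookup (zipWith _+_ (tabulate (colSum h T)) (tabulate (colSum h (not ∘ T)))) i
      ≡⟨ lookup-zipWith _+_ i (tabulate (colSum h T)) (tabulate (colSum h (not ∘ T))) ⟩
    lookup (tabulate (colSum h T)) i + lookup (tabulate (colSum h (not ∘ T))) i
      ≡⟨ cong₂ _+_ (lookup∘tabulate (colSum h T) i) (lookup∘tabulate (colSum h (not ∘ T)) i) ⟩
    colSum h T i + colSum h (not ∘ T) i
      ≡⟨ colSum-complement T i ⟩
    sumFin (h i)
      ≡⟨ lookup∘tabulate (λ i → sumFin (h i)) i ⟨
    lookup (tabulate (λ i → sumFin (h i))) i ∎
    where open ≡-Reasoning

IsPartition-tabulate : ∀ {r} {f : Fin r → ℕ} → IsPartitionF f → IsPartition (tabulate f)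
IsPartition-tabulate {f = f} f-part i k i≤k rewrite lookup∘tabulate f i | lookup∘tabulate f k = f-part i k i≤k

if-mono : ∀ b {x y} → x ≤ y → (if b then x else 0) ≤ (if b then y else 0)
if-mono true x≤y = x≤y
if-mono false _ = z≤n

module ColumnSplit {r s} (lam mu : Vec ℕ r) (A : Matrix r s) (ryser : RyserMatrix lam mu A) where
  open RyserMatrix ryser

  diagram : Matrix r s
  diagram i k = [ toℕ i <ᵇ conj lam (toℕ k) ]

  diagram-columnSum : ∀ k → sumFin (λ i → diagram i k) ≡ conj lam (toℕ k)
  diagram-columnSum k = trans (sumFin-initial r (conj lam (toℕ k))) (m≤n⇒m⊓n≡m (conj≤r lam (toℕ k)))

  diagram-rowSum : IsPartition lam → (∀ i → lookup lam i ≤ s) → ∀ i → sumFin (diagram i) ≡ lookup lam i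
  diagram-rowSum lam-part parts≤s i = begin
    sumFin (diagram i)                       ≡⟨ sumFin-cong (λ k → cong [_] (sym (conj-conj k))) ⟩
    sumFin (λ (k : Fin s) → [ toℕ k <ᵇ lookup lam i ]) ≡⟨ sumFin-initial s (lookup lam i) ⟩
    lookup lam i ⊓ s                         ≡⟨ m≤n⇒m⊓n≡m (parts≤s i) ⟩
    lookup lam i                             ∎
    where
    open ≡-Reasoning
    conj-conj : ∀ (k : Fin s) → (toℕ k <ᵇ lookup lam i) ≡ (toℕ i <ᵇ conj lam (toℕ k))
    conj-conj k = downClosed⇒initial (λ i′ → toℕ k <ᵇ lookup lam i′)
      (λ a b a≤b k<λb → <ᵇ-true (≤-trans (<ᵇ-true⁻¹ (toℕ k) (lookup lam b) k<λb) (lam-part a b a≤b))) i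

  shapeOf rowsOf : (Fin s → Bool) → Vec ℕ r
  shapeOf T = tabulate (colSum diagram T)
  rowsOf T = tabulate (colSum A T)

  shapeOf-partition : ∀ T → IsPartition (shapeOf T)
  shapeOf-partition T = IsPartition-tabulate (λ i i′ i≤i′ → sumFin-mono (λ k → if-mono (T k) (antitone i i′ k i≤i′)))
    where
    antitone : ∀ i i′ k → toℕ i ≤ toℕ i′ → diagram i′ k ≤ diagram i k
    antitone i i′ k i≤i′ with toℕ i′ <ᵇ conj lam (toℕ k) in i′-in
    ... | false = z≤n
    ... | true = ≤-reflexive (cong [_] (sym (<ᵇ-true (≤-<-trans i≤i′ (<ᵇ-true⁻¹ (toℕ i′) (conj lam (toℕ k)) i′-in)))))

  sum-shapeOf≡sum-rowsOf : ∀ T → sum (shapeOf T) ≡ sum (rowsOf T)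
  sum-shapeOf≡sum-rowsOf T = begin
    sum (shapeOf T)                                                 ≡⟨ sum-colSum diagram T ⟩
    sumFin (λ k → if T k then sumFin (λ i → diagram i k) else 0)    ≡⟨ sumFin-cong same-columns ⟩
    sumFin (λ k → if T k then sumFin (λ i → A i k) else 0)          ≡⟨ sum-colSum A T ⟨
    sum (rowsOf T)                                                  ∎
    where
    open ≡-Reasoning
    same-columns : ∀ k → (if T k then sumFin (λ i → diagram i k) else 0) ≡ (if T k then sumFin (λ i → A i k) else 0)
    same-columns k = cong (λ x → if T k then x else 0) (trans (diagram-columnSum k) (sym (columnSum k)))

  -- The top t cells of a 0/1 column with λ′ₖ ones number at most t ⊓ λ′ₖ, with equality in the diagram.
  psum-rowsOf≤psum-shapeOf : ∀ T t → psum t (rowsOf T) ≤ psum t (shapeOf T)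
  psum-rowsOf≤psum-shapeOf T t = begin
    psum t (rowsOf T)                                                                     ≡⟨ psum-colSum A t T ⟩
    sumFin (λ k → if T k then sumFin (λ i → if toℕ i <ᵇ t then A i k else 0) else 0)       ≤⟨ sumFin-mono (λ k → if-mono (T k) (top-cells k)) ⟩
    sumFin (λ k → if T k then sumFin (λ i → if toℕ i <ᵇ t then diagram i k else 0) else 0) ≡⟨ psum-colSum diagram t T ⟨
    psum t (shapeOf T)                                                                    ∎
    where
    open ≤-Reasoning
    top-cells : ∀ k → sumFin (λ i → if toℕ i <ᵇ t then A i k else 0) ≤ sumFin (λ i → if toℕ i <ᵇ t then diagram i k else 0)
    top-cells k = begin
      sumFin (λ i → if toℕ i <ᵇ t then A i k else 0)       ≤⟨ sumFin-initial≤⊓ (λ i → A i k) (λ i → entry≤1 i k) t ⟩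
      t ⊓ sumFin (λ i → A i k)                             ≡⟨ cong (t ⊓_) (columnSum k) ⟩
      t ⊓ conj lam (toℕ k)                                 ≡⟨ sumFin-initial-⊓ r t (conj lam (toℕ k)) (conj≤r lam (toℕ k)) ⟨
      sumFin (λ i → if toℕ i <ᵇ t then diagram i k else 0) ∎

  split-inKostka : ∀ T → IsPartitionF (colSum A T) → InKostka (shapeOf T) (rowsOf T)
  split-inKostka T rows-part =
    shapeOf-partition T , IsPartition-tabulate rows-part , sum-shapeOf≡sum-rowsOf T , psum-rowsOf≤psum-shapeOf T

  split-nonzero : ∀ T k → T k ≡ true → 0 < conj lam (toℕ k) → NonZeroPair (shapeOf T) (rowsOf T)
  split-nonzero T k Tk column-nonempty (shape≡0 , _) = <⇒≱ (begin-strict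
    0
      <⟨ column-nonempty ⟩
    conj lam (toℕ k)
      ≡⟨ trans (cong (λ b → if b then sumFin (λ i → diagram i k) else 0) Tk) (diagram-columnSum k) ⟨
    (if T k then sumFin (λ i → diagram i k) else 0)
      ≤⟨ sumFin-point (λ k → if T k then sumFin (λ i → diagram i k) else 0) k ⟩
    sumFin (λ k → if T k then sumFin (λ i → diagram i k) else 0)
      ≡⟨ sum-colSum diagram T ⟨
    sum (shapeOf T)
      ≡⟨ trans (cong sum shape≡0) (sum-replicate-zero r) ⟩
    0 ∎) ≤-refl
    where open ≤-Reasoning

  shapeOf-complement : IsPartition lam → (∀ i → lookup lam i ≤ s) → ∀ T →
                       lam ≡ zipWith _+_ (shapeOf T) (shapeOf (not ∘ T))
  shapeOf-complement lam-part parts≤s T = trans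
    (lookup-ext λ i → trans (sym (diagram-rowSum lam-part parts≤s i)) (sym (lookup∘tabulate (λ i → sumFin (diagram i)) i)))
    (sym (tabulate-colSum-complement diagram T))

  rowsOf-complement : ∀ T → mu ≡ zipWith _+_ (rowsOf T) (rowsOf (not ∘ T))
  rowsOf-complement T = trans
    (lookup-ext λ i → trans (sym (rowSum i)) (sym (lookup∘tabulate (λ i → sumFin (A i)) i)))
    (sym (tabulate-colSum-complement A T))

proposition2p11 : (r : ℕ) (lam mu : Vec ℕ r) → InKostka lam mu →
    MatrixReducible (canonical lam mu) → KostkaReducible lam mu
proposition2p11 zero [] [] _ (_ , (() , _) , _)
proposition2p11 (suc r) lam@(l ∷ _) mu K@(lam-part , _) (S , (k , Sk) , (k′ , Sk′) , S-part , Sᶜ-part) =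
  shapeOf S , rowsOf S , shapeOf Sᶜ , rowsOf Sᶜ ,
  split-inKostka S S-part , split-inKostka Sᶜ Sᶜ-part ,
  split-nonzero S k Sk (column-nonempty k) , split-nonzero Sᶜ k′ (cong not Sk′) (column-nonempty k′) ,
  shapeOf-complement lam-part (λ i → lam-part zero i z≤n) S , rowsOf-complement S
  where
  open ColumnSplit lam mu (canonical lam mu) (canonical-ryser lam mu K)
  Sᶜ : Fin l → Bool
  Sᶜ = not ∘ S
  column-nonempty : ∀ k → 0 < conj lam (toℕ k)
  column-nonempty k = ≤-trans (≤-reflexive (cong [_] (sym (<ᵇ-true (Fin.toℕ<n k)))))
                              (sumFin-point (λ i → [ toℕ k <ᵇ lookup lam i ]) zero)
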